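{- Let $I$ be an interval-poset of size $n$. Then $(a,b)$ is a Tamari inversion of $I$ if and only if $(n+1-b,n+1-a)$ is a Tamari inversion of $\mathrm{compl}(I)$; in particular $\mathrm{dist}(I)=\mathrm{dist}(\mathrm{compl}(I))$.
   Context: An interval-poset of size $n$ is a partial order $\triangleleft$ on $\{1,\dots,n\}$ with $a\triangleleft c\Rightarrow b\triangleleft c$ and $c\triangleleft a\Rightarrow b\triangleleft a$ for all $a<b<c$; interval-posets correspond bijectively to Tamari intervals $[T_1,T_2]$ of binary trees (nodes $v_1,\dots,v_n$ in in-order) via: for $a<b$, $b\triangleleft a$ iff $v_b$ in right subtree of $v_a$ in $T_1$, $a\triangleleft b$ iff $v_a$ in left subtree of $v_b$ in $T_2$. $\mathrm{dist}(I)$ is the maximal length of a chain from $T_1$ to $T_2$ in the Tamari lattice (order generated by right rotations $y(x(A,B),C)\to x(A,y(B,C))$). A Tamari inversion of $I$ is a pair $(a,b)$, $1\le a<b\le n$, such that there is no $k$ with $a\le k<b$ and $b\triangleleft k$, and no $k$ with $a<k\le b$ and $a\triangleleft k$. The complement $\mathrm{compl}(I)$ is the interval-poset $J$ with $i\triangleleft_J j$ iff $(n+1-i)\triangleleft_I(n+1-j)$. -}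

module Defs where

open import Data.Nat using (ℕ; zero; suc; _+_; _∸_; _≤_; _<_)
open import Data.Product using (Σ; _×_; ∃-syntax)
open import Data.Sum using (_⊎_)
open import Relation.Nullary using (¬_)
open import Relation.Binary.PropositionalEquality using (_≡_)

Rel : Set₁
Rel = ℕ → ℕ → Set

InRange : ℕ → ℕ → Set
InRange n a = 1 ≤ a × a ≤ n

record IsIntervalPoset (n : ℕ) (R : Rel) : Set where
  field
    support  : ∀ {a b} → R a b → InRange n a × InRange n b
    refl     : ∀ {a} → InRange n a → R a a
    antisym  : ∀ {a b} → R a b → R b a → a ≡ b
    trans    : ∀ {a b c} → R a b → R b c → R a c
    interval₁ : ∀ {a b c} → a < b → b < c → R a c → R b c
    interval₂ : ∀ {a b c} → a < b → b < c → R c a → R b a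

TamariInversion : ℕ → Rel → ℕ → ℕ → Set
TamariInversion n R a b =
  1 ≤ a × a < b × b ≤ n
  × ¬ (∃[ k ] (a ≤ k × k < b × R b k))
  × ¬ (∃[ k ] (a < k × k ≤ b × R a k))

compl : ℕ → Rel → Rel
compl n R i j = R (suc n ∸ i) (suc n ∸ j)

data Tree : Set where
  leaf : Tree
  node : Tree → Tree → Tree

size : Tree → ℕ
size leaf       = 0
size (node l r) = suc (size l + size r)

data Rot : Tree → Tree → Set where
  root  : ∀ A B C → Rot (node (node A B) C) (node A (node B C))
  left  : ∀ {l l′} r → Rot l l′ → Rot (node l r) (node l′ r)
  right : ∀ l {r r′} → Rot r r′ → Rot (node l r) (node l r′)

data RotPath : Tree → Tree → ℕ → Set where
  done : ∀ {T} → RotPath T T 0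
  step : ∀ {S S′ T k} → Rot S S′ → RotPath S′ T k → RotPath S T (suc k)

_≤T_ : Tree → Tree → Set
S ≤T T = ∃[ k ] RotPath S T k

-- IsDist S T d : d is the maximal length of a chain from S to T
-- (maximal chains in the Tamari lattice consist of right rotations).
IsDist : Tree → Tree → ℕ → Set
IsDist S T d = RotPath S T d × (∀ m → RotPath S T m → m ≤ d)

-- In-order labelling: nodes of a tree with offset o are labelled
-- o+1, …, o+size; the root of node L R has label o + size L + 1.

-- RightDesc o T a b : node b lies in the right subtree of node a.
data RightDesc : ℕ → Tree → ℕ → ℕ → Set where
  here : ∀ {o L R b} → suc (o + size L) < b → b ≤ suc (o + size L) + size R →
         RightDesc o (node L R) (suc (o + size L)) b
  inL  : ∀ {o L R a b} → RightDesc o L a b → RightDesc o (node L R) a b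
  inR  : ∀ {o L R a b} → RightDesc (suc (o + size L)) R a b →
         RightDesc o (node L R) a b

-- LeftDesc o T a b : node a lies in the left subtree of node b.
data LeftDesc : ℕ → Tree → ℕ → ℕ → Set where
  here : ∀ {o L R a} → o < a → a ≤ o + size L →
         LeftDesc o (node L R) a (suc (o + size L))
  inL  : ∀ {o L R a b} → LeftDesc o L a b → LeftDesc o (node L R) a b
  inR  : ∀ {o L R a b} → LeftDesc (suc (o + size L)) R a b →
         LeftDesc o (node L R) a b

intervalPoset : Tree → Tree → Rel
intervalPoset T₁ T₂ x y =
  (x ≡ y × InRange (size T₁) x)
  ⊎ (x < y × LeftDesc 0 T₂ x y)
  ⊎ (y < x × RightDesc 0 T₁ y x)

module Submission where

-- Write m = n + 1.  The reflection k ↦ m ∸ k is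
-- an order-reversing involution of [0, m], and compl n R is R read through it.
-- A witness k forbidding (m ∸ b , m ∸ a) in compl n R reflects to a witness
-- m ∸ k forbidding (a , b) in R (the two kinds of witnesses are exchanged), so
-- inversions of R give inversions of compl n R.  The converse is the same
-- statement for compl n R, because compl n (compl n R) agrees with R on [1, n]
-- and Tamari inversions only look at R on [1, n].
--
-- If the interval-poset of [U₁ , U₂] is the complement of
-- that of [T₁ , T₂], then U₁ = mirror T₂ and U₂ = mirror T₁: left descent in a
-- tree is right descent in its mirror with labels reflected, and a tree is
-- determined by its right-descendant relation.  Mirroring reverses right
-- rotations, hence maps rotation chains T₁ → T₂ of length d to rotation chains
-- mirror T₂ → mirror T₁ of length d, and the distances agree.

open import Defs
open import Data.Nat using (ℕ; suc; _+_; _∸_; _≤_; _<_; s≤s; s≤s⁻¹)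
open import Data.Nat.Properties
open import Data.Nat.Tactic.RingSolver using (solve-∀)
open import Data.Product using (_×_; _,_; proj₁; proj₂; ∃-syntax)
open import Data.Sum using (inj₁; inj₂)
open import Data.Empty using (⊥-elim)
open import Relation.Nullary using (¬_)
open import Relation.Binary.PropositionalEquality
  using (_≡_; refl; sym; trans; cong; cong₂; subst; subst₂; module ≡-Reasoning)
open import Function.Bundles using (_⇔_; mk⇔; Equivalence)
open import Function.Properties.Equivalence using () renaming (trans to ⇔-trans)
open import Function.Construct.Symmetry using (⇔-sym)

reflect-< : ∀ {x x′ y y′} → x + x′ ≡ y + y′ → x < y → y′ < x′
reflect-< e x<y = ≰⇒> λ x′≤y′ → <-irrefl e (+-mono-<-≤ x<y x′≤y′)

flip-<ˡ : ∀ {m x k} → x ≤ m → k < m ∸ x → x < m ∸ k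
flip-<ˡ {m} {x} {k} x≤m k< = subst (_< m ∸ k) (m∸[m∸n]≡n x≤m) (∸-monoʳ-< k< (m∸n≤m m x))

flip-≤ˡ : ∀ {m x k} → x ≤ m → k ≤ m ∸ x → x ≤ m ∸ k
flip-≤ˡ {m} {x} {k} x≤m k≤ = subst (_≤ m ∸ k) (m∸[m∸n]≡n x≤m) (∸-monoʳ-≤ m k≤)

flip-≤ʳ : ∀ {m x k} → x ≤ m → m ∸ x ≤ k → m ∸ k ≤ x
flip-≤ʳ {m} {x} {k} x≤m ≤k = subst (m ∸ k ≤_) (m∸[m∸n]≡n x≤m) (∸-monoʳ-≤ m ≤k)

flip-<ʳ : ∀ {m x k} → x ≤ m → k ≤ m → m ∸ x < k → m ∸ k < x
flip-<ʳ {m} {x} {k} x≤m k≤m <k = subst (m ∸ k <_) (m∸[m∸n]≡n x≤m) (∸-monoʳ-< <k k≤m)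

0<∸⇒< : ∀ {m x} → 0 < m ∸ x → x < m
0<∸⇒< 0<m∸x = m∸n≢0⇒n<m λ e → <-irrefl (sym e) 0<m∸x

reflect-relation : ∀ {m} {P Q : Rel} →
  (∀ {x y} → x ≤ m → y ≤ m → P x y ⇔ Q (m ∸ x) (m ∸ y)) →
  (∀ {x y} → x ≤ m → y ≤ m → Q x y ⇔ P (m ∸ x) (m ∸ y))
reflect-relation {m} {P} {Q} H {x} {y} x≤m y≤m =
  ⇔-sym (subst₂ (λ u v → P (m ∸ x) (m ∸ y) ⇔ Q u v) (m∸[m∸n]≡n x≤m) (m∸[m∸n]≡n y≤m)
           (H (m∸n≤m m x) (m∸n≤m m y)))

inversion-antitone : ∀ {n} {R R′ : Rel} → (∀ {x y} → x ≤ n → y ≤ n → R x y → R′ x y) →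
  ∀ {a b} → TamariInversion n R′ a b → TamariInversion n R a b
inversion-antitone R⊆R′ (1≤a , a<b , b≤n , noLeft , noRight) =
  1≤a , a<b , b≤n ,
  (λ (k , a≤k , k<b , bk) → noLeft (k , a≤k , k<b , R⊆R′ b≤n (<⇒≤ (<-≤-trans k<b b≤n)) bk)) ,
  (λ (k , a<k , k≤b , ak) → noRight (k , a<k , k≤b , R⊆R′ (≤-trans (<⇒≤ a<b) b≤n) (≤-trans k≤b b≤n) ak))

-- An inversion (a , b) of R reflects to the inversion (m ∸ b , m ∸ a) of compl n R;
-- a witness k of either kind for the latter gives the witness m ∸ k of the other kind.
complement-inversion : ∀ n (R : Rel) {a b} → TamariInversion n R a b →
  TamariInversion n (compl n R) (suc n ∸ b) (suc n ∸ a)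
complement-inversion n R {a} {b} (1≤a , a<b , b≤n , noLeft , noRight) =
  m<n⇒0<n∸m (s≤s b≤n) , ∸-monoʳ-< a<b b≤m , ∸-monoʳ-≤ m 1≤a , noLeft′ , noRight′
  where
  m : ℕ
  m = suc n
  b≤m : b ≤ m
  b≤m = m≤n⇒m≤1+n b≤n
  a≤m : a ≤ m
  a≤m = ≤-trans (<⇒≤ a<b) b≤m
  noLeft′ : ¬ (∃[ k ] (m ∸ b ≤ k × k < m ∸ a × compl n R (m ∸ a) k))
  noLeft′ (k , b′≤k , k<a′ , a′k) =
    noRight (m ∸ k , flip-<ˡ a≤m k<a′ , flip-≤ʳ b≤m b′≤k ,
             subst (λ x → R x (m ∸ k)) (m∸[m∸n]≡n a≤m) a′k)
  noRight′ : ¬ (∃[ k ] (m ∸ b < k × k ≤ m ∸ a × compl n R (m ∸ b) k))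
  noRight′ (k , b′<k , k≤a′ , b′k) =
    noLeft (m ∸ k , flip-≤ˡ a≤m k≤a′ , flip-<ʳ b≤m (≤-trans k≤a′ (m∸n≤m m a)) b′<k ,
            subst (λ x → R x (m ∸ k)) (m∸[m∸n]≡n b≤m) b′k)

-- The converse: apply complement-inversion to compl n R and undo the double reflection.
complement-inversion⁻¹ : ∀ n (R : Rel) {a b} →
  TamariInversion n (compl n R) (suc n ∸ b) (suc n ∸ a) → TamariInversion n R a b
complement-inversion⁻¹ n R {a} {b} inv@(0<b′ , b′<a′ , _) =
  inversion-antitone R⊆compl²
    (subst₂ (TamariInversion n (compl n (compl n R))) (m∸[m∸n]≡n a≤m) (m∸[m∸n]≡n b≤m)
      (complement-inversion n (compl n R) inv))
  where
  m : ℕ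
  m = suc n
  a≤m : a ≤ m
  a≤m = <⇒≤ (0<∸⇒< (<-trans 0<b′ b′<a′))
  b≤m : b ≤ m
  b≤m = <⇒≤ (0<∸⇒< 0<b′)
  R⊆compl² : ∀ {x y} → x ≤ n → y ≤ n → R x y → compl n (compl n R) x y
  R⊆compl² x≤n y≤n = subst₂ R (sym (m∸[m∸n]≡n (m≤n⇒m≤1+n x≤n))) (sym (m∸[m∸n]≡n (m≤n⇒m≤1+n y≤n)))

complement-inversions : ∀ n (R : Rel) a b →
  TamariInversion n R a b ⇔ TamariInversion n (compl n R) (n + 1 ∸ b) (n + 1 ∸ a)
complement-inversions n R a b =
  subst (λ m → TamariInversion n R a b ⇔ TamariInversion n (compl n R) (m ∸ b) (m ∸ a))
        (+-comm 1 n) (mk⇔ (complement-inversion n R) (complement-inversion⁻¹ n R))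

-- Mirror image, reversing the in-order labelling.
mirror : Tree → Tree
mirror leaf       = leaf
mirror (node l r) = node (mirror r) (mirror l)

size-mirror : ∀ T → size (mirror T) ≡ size T
size-mirror leaf       = refl
size-mirror (node l r) =
  cong suc (trans (cong₂ _+_ (size-mirror r) (size-mirror l)) (+-comm (size r) (size l)))

mirror-involutive : ∀ T → mirror (mirror T) ≡ T
mirror-involutive leaf       = refl
mirror-involutive (node l r) = cong₂ node (mirror-involutive l) (mirror-involutive r)

mirror-swap : ∀ {T U} → U ≡ mirror T → T ≡ mirror U
mirror-swap {T} refl = sym (mirror-involutive T)

rot-mirror : ∀ {S S′} → Rot S S′ → Rot (mirror S′) (mirror S)
rot-mirror (root A B C) = root (mirror C) (mirror B) (mirror A)
rot-mirror (left r p)   = right (mirror r) (rot-mirror p)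
rot-mirror (right l p)  = left (mirror l) (rot-mirror p)

path-snoc : ∀ {S T U k} → RotPath S T k → Rot T U → RotPath S U (suc k)
path-snoc done       r′ = step r′ done
path-snoc (step r p) r′ = step r (path-snoc p r′)

path-mirror : ∀ {S T k} → RotPath S T k → RotPath (mirror T) (mirror S) k
path-mirror done       = done
path-mirror (step r p) = path-snoc (path-mirror p) (rot-mirror r)

dist-mirror : ∀ {S T d} → IsDist S T d → IsDist (mirror T) (mirror S) d
dist-mirror {S} {T} (path , maximal) =
  path-mirror path ,
  λ k q → maximal k (subst₂ (λ x y → RotPath x y k) (mirror-involutive S) (mirror-involutive T)
                             (path-mirror q))

dist-transfer : ∀ {T₁ T₂ U₁ U₂ d} → U₁ ≡ mirror T₂ → U₂ ≡ mirror T₁ →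
  IsDist T₁ T₂ d → IsDist U₁ U₂ d
dist-transfer refl refl = dist-mirror

-- Left descent in T is right descent in mirror T with reflected labels
--
-- Labels of T start after offset o, those of mirror T after o′; a label x of T
-- corresponds to the label x′ of mirror T with x + x′ ≡ N, where
-- N = suc (o + size T + o′).

root-sum : ∀ o o′ L R → suc (o + size L) + suc (o′ + size (mirror R)) ≡ suc (o + size (node L R) + o′)
root-sum o o′ L R = trans (cong (λ s → suc (o + size L) + suc (o′ + s)) (size-mirror R))
                          (identity o o′ (size L) (size R))
  where
  identity : ∀ o o′ l r → suc (o + l) + suc (o′ + r) ≡ suc (o + suc (l + r) + o′)
  identity = solve-∀

right-total : ∀ o o′ L R → suc (suc (o + size L) + size R + o′) ≡ suc (o + size (node L R) + o′)
right-total o o′ L R = identity o o′ (size L) (size R)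
  where
  identity : ∀ o o′ l r → suc (suc (o + l) + r + o′) ≡ suc (o + suc (l + r) + o′)
  identity = solve-∀

shift-mirror : ∀ o x L → o + suc (x + size (mirror L)) ≡ suc (o + size L) + x
shift-mirror o x L = trans (cong (λ s → o + suc (x + s)) (size-mirror L)) (identity o x (size L))
  where
  identity : ∀ o x l → o + suc (x + l) ≡ suc (o + l) + x
  identity = solve-∀

right-root : ∀ {o L R r a} → r ≡ suc (o + size L) → r < a → a ≤ r + size R → RightDesc o (node L R) r a
right-root refl = here

left-root : ∀ {o L R a r} → r ≡ suc (o + size L) → o < a → a ≤ o + size L → LeftDesc o (node L R) a r
left-root refl = here

left⇒mirror-right : ∀ T {o o′ N a b a′ b′} → suc (o + size T + o′) ≡ N →
  a + a′ ≡ N → b + b′ ≡ N → LeftDesc o T a b → RightDesc o′ (mirror T) b′ a′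
left⇒mirror-right (node L R) {o} {o′} {a′ = a′} {b′} total ea eb (here o<a a≤) =
  right-root b′-root (reflect-< (trans ea (sym eb)) (s≤s a≤)) a′≤
  where
  b′-root : b′ ≡ suc (o′ + size (mirror R))
  b′-root = +-cancelˡ-≡ (suc (o + size L)) _ _ (trans eb (sym (trans (root-sum o o′ L R) total)))
  a′≤ : a′ ≤ b′ + size (mirror L)
  a′≤ = s≤s⁻¹ (reflect-< (trans (shift-mirror o b′ L) (trans eb (sym ea))) o<a)
left⇒mirror-right (node L R) {o} {o′} total ea eb (inL p) =
  inR (left⇒mirror-right L (trans (root-sum o o′ L R) total) ea eb p)
left⇒mirror-right (node L R) {o} {o′} total ea eb (inR p) =
  inL (left⇒mirror-right R (trans (right-total o o′ L R) total) ea eb p)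

mirror-right⇒left : ∀ T {o o′ N a b a′ b′} → suc (o + size T + o′) ≡ N →
  a′ + a ≡ N → b′ + b ≡ N → RightDesc o′ (mirror T) b′ a′ → LeftDesc o T a b
mirror-right⇒left leaf _ _ _ ()
mirror-right⇒left (node L R) {o} {o′} {a = a} {b} {a′} {b′} total ea eb (here b′<a′ a′≤) =
  left-root b-root (reflect-< sums′ (s≤s a′≤)) (s≤s⁻¹ (subst (a <_) b-root a<b))
  where
  b-root : b ≡ suc (o + size L)
  b-root = +-cancelˡ-≡ b′ _ _
    (trans eb (sym (trans (+-comm b′ _) (trans (root-sum o o′ L R) total))))
  a<b : a < b
  a<b = reflect-< (trans eb (sym ea)) b′<a′
  open ≡-Reasoning
  sums′ : a′ + a ≡ suc (b′ + size (mirror L)) + o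
  sums′ = begin
    a′ + a                          ≡⟨ trans ea (sym eb) ⟩
    b′ + b                          ≡⟨ cong (b′ +_) b-root ⟩
    b′ + suc (o + size L)           ≡⟨ +-comm b′ _ ⟩
    suc (o + size L) + b′           ≡⟨ shift-mirror o b′ L ⟨
    o + suc (b′ + size (mirror L))  ≡⟨ +-comm o _ ⟩
    suc (b′ + size (mirror L)) + o  ∎
mirror-right⇒left (node L R) {o} {o′} total ea eb (inL p) =
  inR (mirror-right⇒left R (trans (right-total o o′ L R) total) ea eb p)
mirror-right⇒left (node L R) {o} {o′} total ea eb (inR p) =
  inL (mirror-right⇒left L (trans (root-sum o o′ L R) total) ea eb p)

left⇔mirror-right : ∀ {n} T → size T ≡ n → ∀ {a b} → a ≤ suc n → b ≤ suc n →
  LeftDesc 0 T (suc n ∸ b) (suc n ∸ a) ⇔ RightDesc 0 (mirror T) a b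
left⇔mirror-right {n} T sizeT a≤m b≤m =
  mk⇔ (left⇒mirror-right T total (m∸n+n≡m b≤m) (m∸n+n≡m a≤m))
      (mirror-right⇒left T total (m+[n∸m]≡n b≤m) (m+[n∸m]≡n a≤m))
  where
  total : suc (0 + size T + 0) ≡ suc n
  total = cong suc (trans (+-identityʳ (size T)) sizeT)

-- A tree is determined by its right-descendant relation

RightSub : ℕ → Tree → Tree → Set
RightSub o T T′ = ∀ {a b} → RightDesc o T a b → RightDesc o T′ a b

node-last : ∀ o L R → suc (o + size L) + size R ≡ o + size (node L R)
node-last o L R = identity o (size L) (size R)
  where
  identity : ∀ o l r → suc (o + l) + r ≡ o + suc (l + r)
  identity = solve-∀

right-range : ∀ {o T a b} → RightDesc o T a b → o < a × a < b × b ≤ o + size T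
right-range {o} (here {L = L} {R} a<b b≤) =
  s≤s (m≤m+n o (size L)) , a<b , ≤-trans b≤ (≤-reflexive (node-last o L R))
right-range {o} (inL {L = L} {R} p) with right-range p
... | o<a , a<b , b≤ = o<a , a<b , ≤-trans b≤ (+-monoʳ-≤ o (≤-trans (m≤m+n (size L) (size R)) (n≤1+n _)))
right-range {o} (inR {L = L} {R} p) with right-range p
... | o′<a , a<b , b≤ =
  <-trans (s≤s (m≤m+n o (size L))) o′<a , a<b , ≤-trans b≤ (≤-reflexive (node-last o L R))

right-in-left : ∀ {o L R a b} → RightDesc o (node L R) a b → a ≤ o + size L → RightDesc o L a b
right-in-left (here _ _) a≤ = ⊥-elim (1+n≰n a≤)
right-in-left (inL p)    _  = p
right-in-left (inR p)    a≤ = ⊥-elim (<⇒≱ (proj₁ (right-range p)) (m≤n⇒m≤1+n a≤))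

right-in-right : ∀ {o L R a b} → RightDesc o (node L R) a b → suc (o + size L) < a →
  RightDesc (suc (o + size L)) R a b
right-in-right (here _ _) r<a = ⊥-elim (<-irrefl refl r<a)
right-in-right (inL p)    r<a with right-range p
... | _ , a<b , b≤ = ⊥-elim (<⇒≱ r<a (≤-trans (<⇒≤ a<b) (m≤n⇒m≤1+n b≤)))
right-in-right (inR p)    _   = p

-- If node L R has the same size as node L′ R′ and its right-descendant pairs
-- occur in node L′ R′, then L′ is no larger than L: otherwise R is nonempty and
-- the root of node L R, whose right descendants reach the last label, lies in L′.
left-size-≤ : ∀ o L R L′ R′ → size (node L R) ≡ size (node L′ R′) →
  RightSub o (node L R) (node L′ R′) → size L′ ≤ size L
left-size-≤ o L R L′ R′ e sub = ≮⇒≥ λ L<L′ → <⇒≱ last>left (last≤left L<L′)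
  where
  last : ℕ
  last = suc (o + size L) + size R
  last>left : o + size L′ < last
  last>left = subst (o + size L′ <_) (sym (trans (node-last o L R) (cong (o +_) e)))
                      (+-monoʳ-< o (s≤s (m≤m+n (size L′) (size R′))))
  R-nonempty : size L < size L′ → 0 < size R
  R-nonempty L<L′ = +-cancelˡ-< (size L) _ _
    (subst₂ _<_ (sym (+-identityʳ (size L))) (sym (suc-injective e))
            (<-≤-trans L<L′ (m≤m+n (size L′) (size R′))))
  last≤left : size L < size L′ → last ≤ o + size L′
  last≤left L<L′ = proj₂ (proj₂ (right-range (right-in-left (sub root-last) root-in-L′)))
    where
    root-last : RightDesc o (node L R) (suc (o + size L)) last
    root-last = here (m<m+n (suc (o + size L)) (R-nonempty L<L′)) ≤-refl
    root-in-L′ : suc (o + size L) ≤ o + size L′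
    root-in-L′ = subst (_≤ o + size L′) (+-suc o (size L)) (+-monoʳ-≤ o L<L′)

restrict-left : ∀ {o L R L′ R′} → size L ≡ size L′ →
  RightSub o (node L R) (node L′ R′) → RightSub o L L′
restrict-left {o} eL sub p with right-range p
... | _ , a<b , b≤ = right-in-left (sub (inL p)) (subst (λ s → _ ≤ o + s) eL (≤-trans (<⇒≤ a<b) b≤))

restrict-right : ∀ {o L R L′ R′} → size L ≡ size L′ →
  RightSub o (node L R) (node L′ R′) → RightSub (suc (o + size L)) R R′
restrict-right {o} {R′ = R′} eL sub p =
  subst (λ s → RightDesc (suc (o + s)) R′ _ _) (sym eL)
        (right-in-right (sub (inR p)) (subst (λ s → suc (o + s) < _) eL (proj₁ (right-range p))))

-- Equal sizes and equal right-descendant relations force equal trees: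
-- the left subtrees have equal sizes, and the relation restricts to both subtrees.
rightDesc-injective : ∀ o T T′ → size T ≡ size T′ → RightSub o T T′ → RightSub o T′ T → T ≡ T′
rightDesc-injective o leaf       leaf         _  _   _    = refl
rightDesc-injective o (node L R) (node L′ R′) e sub sub′ =
  cong₂ node (rightDesc-injective o L L′ eL (restrict-left eL sub) (restrict-left (sym eL) sub′))
             (rightDesc-injective _ R R′ eR (restrict-right eL sub) sub′R)
  where
  eL : size L ≡ size L′
  eL = ≤-antisym (left-size-≤ o L′ R′ L R (sym e) sub′) (left-size-≤ o L R L′ R′ e sub)
  eR : size R ≡ size R′
  eR = +-cancelˡ-≡ (size L) _ _ (trans (suc-injective e) (cong (_+ size R′) (sym eL)))
  sub′R : RightSub (suc (o + size L)) R′ R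
  sub′R = subst (λ s → RightSub (suc (o + s)) R′ R) (sym eL) (restrict-right (sym eL) sub′)

poset-increasing : ∀ {T₁ T₂ a b} → a < b → intervalPoset T₁ T₂ a b ⇔ LeftDesc 0 T₂ a b
poset-increasing {a = a} {b} a<b = mk⇔ to (λ d → inj₂ (inj₁ (a<b , d)))
  where
  to : ∀ {T₁ T₂} → intervalPoset T₁ T₂ a b → LeftDesc 0 T₂ a b
  to (inj₁ (a≡b , _))        = ⊥-elim (<-irrefl a≡b a<b)
  to (inj₂ (inj₁ (_ , d)))   = d
  to (inj₂ (inj₂ (b<a , _))) = ⊥-elim (<-asym a<b b<a)

poset-decreasing : ∀ {T₁ T₂ a b} → a < b → intervalPoset T₁ T₂ b a ⇔ RightDesc 0 T₁ a b
poset-decreasing {a = a} {b} a<b = mk⇔ to (λ d → inj₂ (inj₂ (a<b , d)))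
  where
  to : ∀ {T₁ T₂} → intervalPoset T₁ T₂ b a → RightDesc 0 T₁ a b
  to (inj₁ (b≡a , _))        = ⊥-elim (<-irrefl (sym b≡a) a<b)
  to (inj₂ (inj₁ (b<a , _))) = ⊥-elim (<-asym a<b b<a)
  to (inj₂ (inj₂ (_ , d)))   = d

complement-lower : ∀ {n T₁ T₂ U₁ U₂} → size T₂ ≡ n → size U₁ ≡ n →
  (∀ {x y} → x ≤ suc n → y ≤ suc n →
     intervalPoset U₁ U₂ x y ⇔ intervalPoset T₁ T₂ (suc n ∸ x) (suc n ∸ y)) →
  U₁ ≡ mirror T₂
complement-lower {n} {T₁} {T₂} {U₁} {U₂} sizeT₂ sizeU₁ H =
  rightDesc-injective 0 U₁ (mirror T₂) (trans sizeU₁ (sym (trans (size-mirror T₂) sizeT₂)))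
    (λ p → Equivalence.to   (descents (bounds sizeU₁ p)) p)
    (λ p → Equivalence.from (descents (bounds (trans (size-mirror T₂) sizeT₂) p)) p)
  where
  bounds : ∀ {T a b} → size T ≡ n → RightDesc 0 T a b → a < b × b ≤ suc n
  bounds sizeT p = proj₁ (proj₂ (right-range p)) ,
                   m≤n⇒m≤1+n (subst (_ ≤_) sizeT (proj₂ (proj₂ (right-range p))))
  descents : ∀ {a b} → a < b × b ≤ suc n → RightDesc 0 U₁ a b ⇔ RightDesc 0 (mirror T₂) a b
  descents {a} (a<b , b≤m) =
    ⇔-trans (⇔-sym (poset-decreasing a<b))
    (⇔-trans (H b≤m a≤m)
    (⇔-trans (poset-increasing (∸-monoʳ-< a<b b≤m))
             (left⇔mirror-right T₂ sizeT₂ a≤m b≤m)))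
    where
    a≤m : a ≤ suc n
    a≤m = ≤-trans (<⇒≤ a<b) b≤m

complement-dist : ∀ n (T₁ T₂ U₁ U₂ : Tree) →
  size T₁ ≡ n → size T₂ ≡ n → size U₁ ≡ n → size U₂ ≡ n →
  (∀ x y → intervalPoset U₁ U₂ x y ⇔ compl n (intervalPoset T₁ T₂) x y) →
  ∀ d → IsDist T₁ T₂ d ⇔ IsDist U₁ U₂ d
complement-dist n T₁ T₂ U₁ U₂ sizeT₁ sizeT₂ sizeU₁ sizeU₂ H d =
  mk⇔ (dist-transfer U₁-mirror (mirror-swap T₁-mirror))
      (dist-transfer T₁-mirror (mirror-swap U₁-mirror))
  where
  H′ : ∀ {x y} → x ≤ suc n → y ≤ suc n →
       intervalPoset U₁ U₂ x y ⇔ intervalPoset T₁ T₂ (suc n ∸ x) (suc n ∸ y)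
  H′ {x} {y} _ _ = H x y
  U₁-mirror : U₁ ≡ mirror T₂
  U₁-mirror = complement-lower sizeT₂ sizeU₁ H′
  T₁-mirror : T₁ ≡ mirror U₂
  T₁-mirror = complement-lower sizeU₂ sizeT₁
                (reflect-relation {P = intervalPoset U₁ U₂} {Q = intervalPoset T₁ T₂} H′)

-- Proposition 4.23.  Neither part needs the interval-poset axioms nor the
-- hypotheses T₁ ≤T T₂ and U₁ ≤T U₂.
proposition4p23 : (∀ (n : ℕ) (R : Rel) → IsIntervalPoset n R → ∀ (a b : ℕ) →
    TamariInversion n R a b ⇔ TamariInversion n (compl n R) (n + 1 ∸ b) (n + 1 ∸ a))
    × (∀ (n : ℕ) (T₁ T₂ U₁ U₂ : Tree) →
    size T₁ ≡ n → size T₂ ≡ n → size U₁ ≡ n → size U₂ ≡ n →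
    T₁ ≤T T₂ → U₁ ≤T U₂ →
    (∀ x y → intervalPoset U₁ U₂ x y ⇔ compl n (intervalPoset T₁ T₂) x y) →
    ∀ (d : ℕ) → IsDist T₁ T₂ d ⇔ IsDist U₁ U₂ d)
proposition4p23 =
  (λ n R _ → complement-inversions n R) ,
  (λ n T₁ T₂ U₁ U₂ sizeT₁ sizeT₂ sizeU₁ sizeU₂ _ _ → complement-dist n T₁ T₂ U₁ U₂ sizeT₁ sizeT₂ sizeU₁ sizeU₂)
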